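{- Let $\Lambda,\Gamma$ be $S$-sorted sets of formulas, $s\in S$ and $\varphi,\phi\in Form_s$. The following are equivalent: (i) $\Gamma\cup\{\varphi\}^S\vdash_{\mathbf K\Lambda}\phi$; (ii) $\Gamma\vdash_{\mathbf K\Lambda}\varphi_1\wedge\cdots\wedge\varphi_n\to\phi$ for some $\varphi_1,\ldots,\varphi_n\in(\{\varphi\}_G)_s$.
   Context: Let $(S,\Sigma)$ be a many-sorted signature (each $\sigma\in\Sigma$ has a type $s_1\ldots s_n\to s$, $n\ge0$; $\Sigma_{s_1\ldots s_n,s}$ the symbols of that type; $[n]=\{1,\ldots,n\}$), and $P=\{P_s\}_{s\in S}$ nonempty pairwise disjoint sets of propositional variables. Formulas $Form_s$: $P_s\subseteq Form_s$, closure under $\neg,\vee$ within a sort, and $\sigma(\phi_1,\ldots,\phi_n)\in Form_s$ for $\sigma\in\Sigma_{s_1\ldots s_n,s}$, $\phi_i\in Form_{s_i}$. Abbreviations: $\wedge,\to,\leftrightarrow$; for $n\ge1$, $\sigma^\Box(\phi_1,\ldots,\phi_n):=\neg\sigma(\neg\phi_1,\ldots,\neg\phi_n)$. $\mathbf K=\{\mathbf K_s\}$: the least $S$-sorted set containing in each sort all classical propositional theorems and, for $n\ge1$, $\sigma\in\Sigma_{s_1\ldots s_n,s}$, $i\in[n]$, $\psi_j\in Form_{s_j}$, $\phi,\chi\in Form_{s_i}$, the axioms $\sigma^\Box(\ldots,\phi\to\chi,\ldots)\to(\sigma^\Box(\ldots,\phi,\ldots)\to\sigma^\Box(\ldots,\chi,\ldots))$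 (position $i$, other arguments $\psi_j$) and $\sigma(\psi_1,\ldots,\psi_n)\leftrightarrow\neg\sigma^\Box(\neg\psi_1,\ldots,\neg\psi_n)$. $\mathbf K\Lambda_s$ is $\mathbf K_s$ plus all sort-preserving uniform substitution instances of formulas of $\Lambda_s$ (its elements are the axioms). Rules: modus ponens (MP) within a sort; universal generalization (UG): from $\phi\in Form_{s_i}$ infer $\sigma^\Box(\psi_1,\ldots,\psi_{i-1},\phi,\psi_{i+1},\ldots,\psi_n)$ for $\sigma\in\Sigma_{s_1\ldots s_n,s}$, $n\ge1$, $i\in[n]$, $\psi_j\in Form_{s_j}$. Global deduction: for an $S$-sorted set $\Gamma=\{\Gamma_s\}$ and $\phi\in Form_s$, $\Gamma\vdash_{\mathbf K\Lambda}\phi$ means there is a sequence $\phi_1,\ldots,\phi_m=\phi$ of formulas (of arbitrary sorts $s_i$) each of which is in $\mathbf K\Lambda_{s_i}$, or in $\Gamma_{s_i}$, or follows from earlier ones by MP or UG. For $\varphi\in Form_s$, $\{\varphi\}^S$ is the $S$-sorted set with $\{\varphi\}^S_s=\{\varphi\}$ and $\{\varphi\}^S_t=\emptyset$ for $t\ne s$. For an $S$-sorted set $\Delta$, $\Delta_G=\bigcup_k\Delta^k$ where $\Delta^0=\Delta$ and $\Delta^{k+1}_s=\Delta^k_s\cup\{\sigma^\Box(\psi_1,\ldots,\psi_{i-1},\gamma,\psi_{i+1},\ldots,\psi_n)\mid \sigma\in\Sigma_{s_1\ldots s_n,s},n\ge1, i\in[n],\gamma\in\Delta^k_{s_i},\psi_j\in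 Form_{s_j}\}$. $\{\varphi\}_G:=(\{\varphi\}^S)_G$. -}

module Defs where

open import Data.Bool using (Bool; true; false; not) renaming (_∨_ to _∨ᵇ_)
open import Data.List using (List; []; _∷_)
open import Data.List.Relation.Unary.All using (All; []; _∷_; _[_]≔_)
open import Data.List.Membership.Propositional using (_∈_)
open import Data.Product using (_×_; Σ)
open import Data.Sum using (_⊎_)
open import Relation.Binary.PropositionalEquality using (_≡_)

-- Op ss s is the set Σ_{s_1…s_n,s} with ss = s_1…s_n.
-- Disjointness of the P_s is automatic (P is a sort-indexed family).
record Signature : Set₁ where
  field
    Sort        : Set
    Op          : List Sort → Sort → Set
    PV          : Sort → Set
    PV-nonempty : (s : Sort) → PV s

module Syntax (Sg : Signature) where
  open Signature Sg

  infixr 6 _or_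

  data Form : Sort → Set where
    var : ∀ {s} → PV s → Form s
    neg : ∀ {s} → Form s → Form s
    _or_ : ∀ {s} → Form s → Form s → Form s
    app : ∀ {ss s} → Op ss s → All Form ss → Form s

  Args : List Sort → Set
  Args = All Form

  infixr 7 _and_
  infixr 5 _imp_
  infix 4 _iff_

  _and_ : ∀ {s} → Form s → Form s → Form s
  φ and ψ = neg (neg φ or neg ψ)

  _imp_ : ∀ {s} → Form s → Form s → Form s
  φ imp ψ = neg φ or ψ

  _iff_ : ∀ {s} → Form s → Form s → Form s
  φ iff ψ = (φ imp ψ) and (ψ imp φ)

  negArgs : ∀ {ss} → Args ss → Args ss
  negArgs [] = []
  negArgs (φ ∷ φs) = neg φ ∷ negArgs φs

  box : ∀ {ss s} → Op ss s → Args ss → Form s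
  box σ as = neg (app σ (negArgs as))

  -- classical propositional tautologies: true under every Boolean valuation
  -- of the atoms (variables and formulas with main symbol from Σ)
  eval : ∀ {s} → (Form s → Bool) → Form s → Bool
  eval v (var p) = v (var p)
  eval v (neg φ) = not (eval v φ)
  eval v (φ or ψ) = eval v φ ∨ᵇ eval v ψ
  eval v (app σ as) = v (app σ as)

  Tautology : ∀ {s} → Form s → Set
  Tautology φ = ∀ v → eval v φ ≡ true

  Subst : Set
  Subst = ∀ {s} → PV s → Form s

  mutual
    sub : ∀ {s} → Subst → Form s → Form s
    sub τ (var p) = τ p
    sub τ (neg φ) = neg (sub τ φ)
    sub τ (φ or ψ) = sub τ φ or sub τ ψ
    sub τ (app σ as) = app σ (subArgs τ as)

    subArgs : ∀ {ss} → Subst → Args ss → Args ss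
    subArgs τ [] = []
    subArgs τ (φ ∷ φs) = sub τ φ ∷ subArgs τ φs

  SSet : Set₁
  SSet = (s : Sort) → Form s → Set

  data KAx : SSet where
    taut : ∀ {s} {φ : Form s} → Tautology φ → KAx s φ
    kax  : ∀ {ss s t} (σ : Op ss s) (i : t ∈ ss) (ψs : Args ss) (φ χ : Form t) →
           KAx s (box σ (ψs [ i ]≔ (φ imp χ)) imp (box σ (ψs [ i ]≔ φ) imp box σ (ψs [ i ]≔ χ)))
    dual : ∀ {t ts s} (σ : Op (t ∷ ts) s) (ψs : Args (t ∷ ts)) →
           KAx s (app σ ψs iff neg (box σ (negArgs ψs)))

  data KΛAx (Λ : SSet) : SSet where
    kAx : ∀ {s φ} → KAx s φ → KΛAx Λ s φ
    inst : ∀ {s φ} (τ : Subst) → Λ s φ → KΛAx Λ s (sub τ φ)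

  -- global deduction Γ ⊢_{KΛ} φ (derivations as trees; a formula is
  -- derivable iff it occurs in some deduction sequence)
  data Deriv (Λ Γ : SSet) : SSet where
    ax  : ∀ {s φ} → KΛAx Λ s φ → Deriv Λ Γ s φ
    hyp : ∀ {s φ} → Γ s φ → Deriv Λ Γ s φ
    mp  : ∀ {s} {φ ψ : Form s} → Deriv Λ Γ s φ → Deriv Λ Γ s (φ imp ψ) → Deriv Λ Γ s ψ
    ug  : ∀ {ss s t} (σ : Op ss s) (i : t ∈ ss) (ψs : Args ss) {φ : Form t} →
          Deriv Λ Γ t φ → Deriv Λ Γ s (box σ (ψs [ i ]≔ φ))

  data Single {s : Sort} (φ : Form s) : SSet where
    here : Single φ s φ

  _∪_ : SSet → SSet → SSet
  (Γ ∪ Δ) s φ = Γ s φ ⊎ Δ s φ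

  -- Δ_G = ⋃_k Δ^k (inductive closure under σ^□ in any argument position)
  data Gen (Δ : SSet) : SSet where
    base : ∀ {s φ} → Δ s φ → Gen Δ s φ
    step : ∀ {ss s t} (σ : Op ss s) (i : t ∈ ss) (ψs : Args ss) {γ : Form t} →
           Gen Δ t γ → Gen Δ s (box σ (ψs [ i ]≔ γ))

  -- φ_1 ∧ (φ_2 ∧ (… ∧ φ_n)), n ≥ 1 (given as head φ_1 and tail list)
  conj : ∀ {s} → Form s → List (Form s) → Form s
  conj φ [] = φ
  conj φ (ψ ∷ ψs) = φ and conj ψ ψs

-- By induction on a derivation from Γ ∪ {φ}, the uses of the extra hypothesis can be
-- discharged into a list L of members of {φ}_G with Γ ⊢ L ⇛ χ, the curried implication
-- φ₁ → (φ₂ → … → χ).  Axioms and members of Γ need L = [], φ itself L = [φ], modus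
-- ponens concatenates the lists, and generalisation maps σ^□ over L, using the K axioms
-- in the form σ^□(L ⇛ χ) → (σ^□ L ⇛ σ^□ χ).  Uncurrying (and padding an empty L with φ)
-- gives (ii).  Conversely every member of {φ}_G is derivable from {φ} by UG.
module Submission where

open import Defs
open import Data.Bool using (Bool; true; false; not; _∧_; _∨_)
open import Data.Bool.Properties using (∧-conicalˡ; ∧-conicalʳ)
open import Data.Fin using (Fin; zero; suc)
open import Data.List using (List; []; _∷_; _++_; map; foldr)
open import Data.List.Properties using (foldr-++)
open import Data.List.Membership.Propositional using (_∈_)
open import Data.List.Relation.Unary.All as All using (All; []; _∷_; _[_]≔_)
open import Data.List.Relation.Unary.All.Properties using (++⁺; map⁺)
open import Data.Nat using (ℕ; zero; suc)
open import Data.Product using (_×_; Σ; _,_)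
open import Data.Sum using (inj₁; inj₂)
open import Data.Vec using (Vec; []; _∷_; lookup) renaming (map to mapᵛ)
open import Data.Vec.Properties using (lookup-map)
open import Function using (_∘_)
open import Function.Bundles using (_⇔_; mk⇔)
open import Relation.Binary.PropositionalEquality using (_≡_; refl; sym; trans; cong; cong₂; subst)

infix  8 ¬ₛ_
infixr 7 _∧ₛ_
infixr 6 _∨ₛ_
infixr 5 _⇒ₛ_

-- Propositional schemas over n atoms; `Valid` is decided by computing the whole
-- truth table, so each tautology instance used below is certified by `refl`.
data Schema (n : ℕ) : Set where
  atom : Fin n → Schema n
  ¬ₛ_  : Schema n → Schema n
  _∨ₛ_ : Schema n → Schema n → Schema n

_⇒ₛ_ _∧ₛ_ : ∀ {n} → Schema n → Schema n → Schema n
P ⇒ₛ Q = ¬ₛ P ∨ₛ Q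
P ∧ₛ Q = ¬ₛ (¬ₛ P ∨ₛ ¬ₛ Q)

⟦_⟧ : ∀ {n} → Schema n → Vec Bool n → Bool
⟦ atom i ⟧ β = lookup β i
⟦ ¬ₛ P ⟧ β = not (⟦ P ⟧ β)
⟦ P ∨ₛ Q ⟧ β = ⟦ P ⟧ β ∨ ⟦ Q ⟧ β

A : ∀ {n} → Schema (suc n)
A = atom zero

B : ∀ {n} → Schema (suc (suc n))
B = atom (suc zero)

C : ∀ {n} → Schema (suc (suc (suc n)))
C = atom (suc (suc zero))

D : ∀ {n} → Schema (suc (suc (suc (suc n))))
D = atom (suc (suc (suc zero)))

forAll : ∀ {n} → (Vec Bool n → Bool) → Bool
forAll {zero} f = f []
forAll {suc n} f = forAll (λ β → f (true ∷ β)) ∧ forAll (λ β → f (false ∷ β))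

forAll-sound : ∀ {n} (f : Vec Bool n → Bool) → forAll f ≡ true → ∀ β → f β ≡ true
forAll-sound {zero} f h [] = h
forAll-sound {suc n} f h (true ∷ β) = forAll-sound (λ β → f (true ∷ β)) (∧-conicalˡ _ _ h) β
forAll-sound {suc n} f h (false ∷ β) = forAll-sound (λ β → f (false ∷ β)) (∧-conicalʳ _ _ h) β

Valid : ∀ {n} → Schema n → Set
Valid P = forAll ⟦ P ⟧ ≡ true

module Deduction (Sg : Signature) where
  open Signature Sg
  open Syntax Sg

  instantiate : ∀ {s n} → Vec (Form s) n → Schema n → Form s
  instantiate ρ (atom i) = lookup ρ i
  instantiate ρ (¬ₛ P) = neg (instantiate ρ P)
  instantiate ρ (P ∨ₛ Q) = instantiate ρ P or instantiate ρ Q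

  eval-instantiate : ∀ {s n} (v : Form s → Bool) (ρ : Vec (Form s) n) (P : Schema n) →
                     eval v (instantiate ρ P) ≡ ⟦ P ⟧ (mapᵛ (eval v) ρ)
  eval-instantiate v ρ (atom i) = sym (lookup-map i (eval v) ρ)
  eval-instantiate v ρ (¬ₛ P) = cong not (eval-instantiate v ρ P)
  eval-instantiate v ρ (P ∨ₛ Q) = cong₂ _∨_ (eval-instantiate v ρ P) (eval-instantiate v ρ Q)

  valid⇒tautology : ∀ {s n} (P : Schema n) → Valid P → (ρ : Vec (Form s) n) → Tautology (instantiate ρ P)
  valid⇒tautology P valid ρ v = trans (eval-instantiate v ρ P) (forAll-sound ⟦ P ⟧ valid (mapᵛ (eval v) ρ))

  infixr 4 _⇛_

  _⇛_ : ∀ {s} → List (Form s) → Form s → Form s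
  L ⇛ χ = foldr _imp_ χ L

  module _ {ss s t} (σ : Op ss s) (i : t ∈ ss) (ψs : Args ss) where
    boxAt : Form t → Form s
    boxAt χ = box σ (ψs [ i ]≔ χ)

  module _ {Λ Γ : SSet} where
    infix 2 ⊢_

    ⊢_ : ∀ {s} → Form s → Set
    ⊢_ {s} χ = Deriv Λ Γ s χ

    ⊢-valid : ∀ {s n} (P : Schema n) (ρ : Vec (Form s) n) → Valid P → ⊢ instantiate ρ P
    ⊢-valid P ρ valid = ax (kAx (taut (valid⇒tautology P valid ρ)))

    ⊢-id : ∀ {s} (χ : Form s) → ⊢ χ imp χ
    ⊢-id χ = ⊢-valid (A ⇒ₛ A) (χ ∷ []) refl

    ⇛-K : ∀ {s} (L : List (Form s)) (χ : Form s) → ⊢ χ imp (L ⇛ χ)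
    ⇛-K [] χ = ⊢-id χ
    ⇛-K (x ∷ L) χ =
      mp (⇛-K L χ) (⊢-valid ((A ⇒ₛ B) ⇒ₛ A ⇒ₛ C ⇒ₛ B) (χ ∷ (L ⇛ χ) ∷ x ∷ []) refl)

    ⇛-distrib : ∀ {s} (L : List (Form s)) (χ ψ : Form s) →
                ⊢ (L ⇛ χ imp ψ) imp ((L ⇛ χ) imp (L ⇛ ψ))
    ⇛-distrib [] χ ψ = ⊢-id (χ imp ψ)
    ⇛-distrib (x ∷ L) χ ψ =
      mp (⇛-distrib L χ ψ)
         (⊢-valid ((A ⇒ₛ B ⇒ₛ C) ⇒ₛ (D ⇒ₛ A) ⇒ₛ (D ⇒ₛ B) ⇒ₛ D ⇒ₛ C)
                  ((L ⇛ χ imp ψ) ∷ (L ⇛ χ) ∷ (L ⇛ ψ) ∷ x ∷ []) refl)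

    ⇛-weaken : ∀ {s} (L : List (Form s)) {χ : Form s} → ⊢ χ → ⊢ L ⇛ χ
    ⇛-weaken L {χ} d = mp d (⇛-K L χ)

    ⇛-mp : ∀ {s} (L : List (Form s)) {χ ψ : Form s} → ⊢ L ⇛ χ imp ψ → ⊢ L ⇛ χ → ⊢ L ⇛ ψ
    ⇛-mp L d e = mp e (mp d (⇛-distrib L _ _))

    ⇛-mono : ∀ {s} (L : List (Form s)) {χ ψ : Form s} → ⊢ χ imp ψ → ⊢ L ⇛ χ → ⊢ L ⇛ ψ
    ⇛-mono L d = ⇛-mp L (⇛-weaken L d)

    ⇛-mp-++ : ∀ {s} (L₁ L₂ : List (Form s)) {χ ψ : Form s} →
              ⊢ L₁ ⇛ χ → ⊢ L₂ ⇛ χ imp ψ → ⊢ L₁ ++ L₂ ⇛ ψ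
    ⇛-mp-++ L₁ L₂ {χ} {ψ} d e =
      subst ⊢_ (sym (foldr-++ _imp_ ψ L₁ L₂))
        (⇛-mp L₁ (⇛-mono L₁ (⇛-distrib L₂ χ ψ) (⇛-weaken L₁ e)) (⇛-mono L₁ (⇛-K L₂ χ) d))

    module _ {ss s t} (σ : Op ss s) (i : t ∈ ss) (ψs : Args ss) where
      boxAt-⇛ : (L : List (Form t)) (χ : Form t) →
                ⊢ boxAt σ i ψs (L ⇛ χ) imp (map (boxAt σ i ψs) L ⇛ boxAt σ i ψs χ)
      boxAt-⇛ [] χ = ⊢-id (boxAt σ i ψs χ)
      boxAt-⇛ (x ∷ L) χ =
        ⇛-mono (boxAt σ i ψs (x imp (L ⇛ χ)) ∷ boxAt σ i ψs x ∷ [])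
               (boxAt-⇛ L χ) (ax (kAx (kax σ i ψs x (L ⇛ χ))))

      ⇛-ug : (L : List (Form t)) {χ : Form t} → ⊢ L ⇛ χ → ⊢ map (boxAt σ i ψs) L ⇛ boxAt σ i ψs χ
      ⇛-ug L {χ} d = mp (ug σ i ψs d) (boxAt-⇛ L χ)

    ⇛-uncurry : ∀ {s} (φ₁ : Form s) (φs : List (Form s)) (χ : Form s) →
                ⊢ (φ₁ ∷ φs ⇛ χ) imp (conj φ₁ φs imp χ)
    ⇛-uncurry φ₁ [] χ = ⊢-id (φ₁ imp χ)
    ⇛-uncurry φ₁ (φ₂ ∷ φs) χ =
      mp (⇛-uncurry φ₂ φs χ)
         (⊢-valid ((A ⇒ₛ B ⇒ₛ C) ⇒ₛ (D ⇒ₛ A) ⇒ₛ D ∧ₛ B ⇒ₛ C)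
                  ((φ₂ ∷ φs ⇛ χ) ∷ conj φ₂ φs ∷ χ ∷ φ₁ ∷ []) refl)

    conj-intro : ∀ {s} {φ₁ : Form s} {φs : List (Form s)} → ⊢ φ₁ → All ⊢_ φs → ⊢ conj φ₁ φs
    conj-intro d [] = d
    conj-intro {φ₁ = φ₁} {φ₂ ∷ φs} d (e ∷ es) =
      mp (conj-intro e es) (mp d (⊢-valid (A ⇒ₛ B ⇒ₛ A ∧ₛ B) (φ₁ ∷ conj φ₂ φs ∷ []) refl))

  weaken-∪ : ∀ {Λ Γ Δ : SSet} {s} {χ : Form s} → Deriv Λ Γ s χ → Deriv Λ (Γ ∪ Δ) s χ
  weaken-∪ (ax a) = ax a
  weaken-∪ (hyp g) = hyp (inj₁ g)
  weaken-∪ (mp d e) = mp (weaken-∪ d) (weaken-∪ e)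
  weaken-∪ (ug σ i ψs d) = ug σ i ψs (weaken-∪ d)

  Gen-derivable : ∀ {Λ Γ : SSet} {s} {φ : Form s} {t} {χ : Form t} →
                  Gen (Single φ) t χ → Deriv Λ (Γ ∪ Single φ) t χ
  Gen-derivable (base here) = hyp (inj₂ here)
  Gen-derivable (step σ i ψs g) = ug σ i ψs (Gen-derivable g)

  record Discharged (Λ Γ : SSet) {s} (φ : Form s) {t} (χ : Form t) : Set where
    constructor discharged
    field
      premises   : List (Form t)
      generated  : All (Gen (Single φ) t) premises
      derivation : Deriv Λ Γ t (premises ⇛ χ)

  module _ {Λ Γ : SSet} {s} {φ : Form s} where
    Discharged-mp : ∀ {t} {χ ψ : Form t} →
                    Discharged Λ Γ φ χ → Discharged Λ Γ φ (χ imp ψ) → Discharged Λ Γ φ ψ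
    Discharged-mp (discharged L₁ g₁ d) (discharged L₂ g₂ e) =
      discharged (L₁ ++ L₂) (++⁺ g₁ g₂) (⇛-mp-++ L₁ L₂ d e)

    Discharged-ug : ∀ {ss u t} (σ : Op ss u) (i : t ∈ ss) (ψs : Args ss) {χ : Form t} →
                    Discharged Λ Γ φ χ → Discharged Λ Γ φ (boxAt σ i ψs χ)
    Discharged-ug σ i ψs (discharged L g d) =
      discharged (map (boxAt σ i ψs) L) (map⁺ (All.map (step σ i ψs) g)) (⇛-ug σ i ψs L d)

    discharge : ∀ {t} {χ : Form t} → Deriv Λ (Γ ∪ Single φ) t χ → Discharged Λ Γ φ χ
    discharge (ax a) = discharged [] [] (ax a)
    discharge (hyp (inj₁ g)) = discharged [] [] (hyp g)
    discharge (hyp (inj₂ here)) = discharged (φ ∷ []) (base here ∷ []) (⊢-id φ)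
    discharge (mp d e) = Discharged-mp (discharge d) (discharge e)
    discharge (ug σ i ψs d) = Discharged-ug σ i ψs (discharge d)

  ConjDischarged : (Λ Γ : SSet) {s : Sort} → Form s → Form s → Set
  ConjDischarged Λ Γ {s} φ ϕ =
    Σ (Form s) (λ φ₁ → Σ (List (Form s)) (λ φs →
      (Gen (Single φ) s φ₁ × All (Gen (Single φ) s) φs) × Deriv Λ Γ s (conj φ₁ φs imp ϕ)))

  module _ {Λ Γ : SSet} {s} {φ ϕ : Form s} where
    discharged⇒conj : Discharged Λ Γ φ ϕ → ConjDischarged Λ Γ φ ϕ
    discharged⇒conj (discharged [] [] d) =
      φ , [] , (base here , []) , mp d (⊢-valid (A ⇒ₛ B ⇒ₛ A) (ϕ ∷ φ ∷ []) refl)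
    discharged⇒conj (discharged (φ₁ ∷ φs) (g ∷ gs) d) =
      φ₁ , φs , (g , gs) , mp d (⇛-uncurry φ₁ φs ϕ)

    conj⇒deriv : ConjDischarged Λ Γ φ ϕ → Deriv Λ (Γ ∪ Single φ) s ϕ
    conj⇒deriv (φ₁ , φs , (g , gs) , d) =
      mp (conj-intro (Gen-derivable g) (All.map Gen-derivable gs)) (weaken-∪ d)

mainTheorem5 : (Sg : Signature) →
    let open Signature Sg in
    let open Syntax Sg in
    (Λ Γ : SSet) (s : Sort) (φ ϕ : Form s) →
    Deriv Λ (Γ ∪ Single φ) s ϕ
      ⇔ Σ (Form s) (λ φ₁ → Σ (List (Form s)) (λ φs →
          (Gen (Single φ) s φ₁ × All (Gen (Single φ) s) φs)
            × Deriv Λ Γ s (conj φ₁ φs imp ϕ)))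
mainTheorem5 Sg Λ Γ s φ ϕ = mk⇔ (discharged⇒conj ∘ discharge) conj⇒deriv
  where open Deduction Sg
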